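{- Let $\sigma$ be a finite relational signature with relation symbols $R_i$ of arity $r_i$, let $r(\sigma)=\sum_i r_i$, and let $\mathcal{A}$ be a finite $\sigma$-structure. The following are equivalent: (1) $\mathcal{A}$ satisfies no proper pH-sentence; (2) $\mathcal{A}$ satisfies none of the $r(\sigma)$ minimal proper pH-sentences with respect to $\sigma$; (3) $\mathcal{A}^{r(\sigma)}$ contains an isolated element.
   Context: A pH-sentence is a sentence of $\{\exists,\forall,\wedge\}$-FO, i.e. built from relational atoms of $\sigma$ (no equality, no negation) using $\exists,\forall,\wedge$. A pH-sentence is proper if it has at least one universally quantified variable occurring in some atom of its quantifier-free part. The minimal proper pH-sentences w.r.t. $\sigma$ are, for each $R_i$ and each position $p\in\{1,\dots,r_i\}$, the sentence $\forall x\,\exists y_1\ldots\exists y_{r_i-1}\,R_i(y_1,\dots,y_{p-1},x,y_p,\dots,y_{r_i-1})$ (there are $r(\sigma)$ of them). $\mathcal{A}^k$ is the $k$-fold direct product of $\mathcal{A}$ (domain $A^k$, relations defined coordinatewise). An element is isolated if it occurs in no tuple of any relation. -}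

module Defs where

open import Data.Nat using (ℕ; zero; suc)
open import Data.Fin using (Fin; zero; suc; fromℕ; inject₁; opposite; punchOut; _≟_)
open import Data.Vec using (Vec; []; _∷_; lookup; map; tabulate; sum)
open import Data.Vec.Membership.Propositional using (_∈_)
open import Data.Bool using (Bool; T)
open import Data.Product using (Σ; _×_; ∃)
open import Data.Sum using (_⊎_)
open import Data.Empty using (⊥)
open import Relation.Nullary using (¬_; yes; no)
open import Relation.Binary.PropositionalEquality using (_≡_; sym)

rσ : {m : ℕ} → (Fin m → ℕ) → ℕ
rσ {m} ar = sum (tabulate ar)

module _ {m : ℕ} (ar : Fin m → ℕ) where

  record Structure : Set₁ where
    field
      Carrier : Set
      rel     : (i : Fin m) → Vec Carrier (ar i) → Set

  record FinStructure (n : ℕ) : Set where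
    field
      rel : (i : Fin m) → Vec (Fin n) (ar i) → Bool

  toStructure : {n : ℕ} → FinStructure n → Structure
  toStructure {n} A = record { Carrier = Fin n ; rel = λ i xs → T (FinStructure.rel A i xs) }

  power : Structure → ℕ → Structure
  power S k = record
    { Carrier = Vec (Structure.Carrier S) k
    ; rel = λ i ts → (c : Fin k) → Structure.rel S i (map (λ v → lookup v c) ts)
    }

  Isolated : (S : Structure) → Structure.Carrier S → Set
  Isolated S e = (i : Fin m) (ts : Vec (Structure.Carrier S) (ar i)) →
                 Structure.rel S i ts → ¬ (e ∈ ts)

  -- {∃,∀,∧}-formulas (no equality, no negation) with k free variables (de Bruijn:
  -- variable zero is the most recently bound one)
  data Form (k : ℕ) : Set where
    atom : (i : Fin m) → Vec (Fin k) (ar i) → Form k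
    _∧_  : Form k → Form k → Form k
    ex   : Form (suc k) → Form k
    all  : Form (suc k) → Form k

  PHSentence : Set
  PHSentence = Form 0

  Sat : (S : Structure) {k : ℕ} → Form k → Vec (Structure.Carrier S) k → Set
  Sat S (atom i xs) env = Structure.rel S i (map (λ x → lookup env x) xs)
  Sat S (φ ∧ ψ)     env = Sat S φ env × Sat S ψ env
  Sat S (ex φ)      env = Σ (Structure.Carrier S) (λ a → Sat S φ (a ∷ env))
  Sat S (all φ)     env = (a : Structure.Carrier S) → Sat S φ (a ∷ env)

  _⊨_ : Structure → PHSentence → Set
  S ⊨ φ = Sat S φ []

  Occurs : {k : ℕ} → Fin k → Form k → Set
  Occurs v (atom i xs) = v ∈ xs
  Occurs v (φ ∧ ψ)     = Occurs v φ ⊎ Occurs v ψ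
  Occurs v (ex φ)      = Occurs (suc v) φ
  Occurs v (all φ)     = Occurs (suc v) φ

  Proper : {k : ℕ} → Form k → Set
  Proper (atom i xs) = ⊥
  Proper (φ ∧ ψ)     = Proper φ ⊎ Proper ψ
  Proper (ex φ)      = Proper φ
  Proper (all φ)     = Occurs zero φ ⊎ Proper φ

  -- ∃y_1 … ∃y_r φ, where φ lives in context (x, y_1, …, y_r)
  exs : (r : ℕ) → Form (suc r) → Form 1
  exs zero    φ = φ
  exs (suc r) φ = exs r (ex φ)

  -- the argument tuple (y_1,…,y_{p-1},x,y_p,…,y_r) as de Bruijn indices in a context
  -- of size suc r: x is the outermost variable (fromℕ r), y_l (l = 0..r-1) is opposite l
  minTuple : (r : ℕ) → Fin (suc r) → Fin (suc r) → Fin (suc r)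
  minTuple r p j with p ≟ j
  ... | yes _  = fromℕ r
  ... | no p≢j = inject₁ (opposite (punchOut p≢j))

  minimal′ : (a : ℕ) → ((Fin a → Fin a) → Form a) → Fin a → PHSentence
  minimal′ (suc r) mk p = all (exs r (mk (minTuple r p)))

  -- ∀x ∃y_1…∃y_{r_i - 1} R_i(y_1,…,y_{p-1},x,y_p,…,y_{r_i-1})
  minimal : (i : Fin m) → Fin (ar i) → PHSentence
  minimal i p = minimal′ (ar i) (λ t → atom i (tabulate t)) p

-- A proper sentence has a universally quantified variable x occurring at some place (R_i, p)
-- of an atom.  In a nonempty structure, satisfying the sentence forces every element to occur
-- at place p of some R_i-tuple, which is exactly what the minimal sentence for (i, p) says.
-- Since the relations of A^k are coordinatewise, an element of A^k occurs at a place iff each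
-- of its coordinates does in A (transpose the witnessing tuples).  Hence A^{r(σ)} has an
-- isolated element iff for each of the r(σ) places some element of A never occurs there:
-- put such an element in the coordinate reserved for that place.
module Submission where

open import Defs
open import Data.Nat using (ℕ; _<_; zero; suc; z≤n; s≤s)
open import Data.Fin using (Fin; zero; suc; fromℕ; inject₁; opposite; punchOut; punchIn; _≟_; splitAt; _↑ˡ_; _↑ʳ_)
open import Data.Fin.Properties using (punchIn-punchOut; opposite-involutive; splitAt-↑ˡ; splitAt-↑ʳ; any?; ¬∀⟶∃¬)
open import Data.Vec using (Vec; []; _∷_; _∷ʳ_; lookup; map; tabulate)
open import Data.Vec.Properties using (lookup-map; lookup∘tabulate; tabulate∘lookup; tabulate-cong)
open import Data.Vec.Relation.Unary.Any using (index)
open import Data.Vec.Relation.Unary.Any.Properties using (lookup-index)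
open import Data.Vec.Membership.Propositional.Properties using (∈-lookup; ∈-tabulate⁺)
open import Data.Product using (Σ; _×_; ∃; _,_; proj₁; proj₂)
open import Data.Sum using (inj₁; inj₂)
open import Function using (_∘_)
open import Function.Bundles using (_⇔_; mk⇔; Equivalence)
open import Function.Construct.Identity using (⇔-id)
open import Relation.Nullary using (¬_; Dec; yes; no; contradiction)
open import Relation.Nullary.Decidable using (T?; _×-dec_; map′)
open import Level using (0ℓ)
open import Relation.Unary using (Pred; Decidable)
open import Relation.Binary.PropositionalEquality using (_≡_; refl; sym; trans; cong; subst; module ≡-Reasoning)

open Equivalence using (to; from)

private variable
  A B : Set
  k n r : ℕ

lookup-extensionality : (xs ys : Vec A k) → (∀ j → lookup xs j ≡ lookup ys j) → xs ≡ ys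
lookup-extensionality xs ys eq = begin
  xs                   ≡⟨ tabulate∘lookup xs ⟨
  tabulate (lookup xs) ≡⟨ tabulate-cong eq ⟩
  tabulate (lookup ys) ≡⟨ tabulate∘lookup ys ⟩
  ys                   ∎
  where open ≡-Reasoning

lookup-∷ʳ-fromℕ : (ys : Vec A r) (c : A) → lookup (ys ∷ʳ c) (fromℕ r) ≡ c
lookup-∷ʳ-fromℕ []       c = refl
lookup-∷ʳ-fromℕ (y ∷ ys) c = lookup-∷ʳ-fromℕ ys c

lookup-∷ʳ-inject₁ : (ys : Vec A r) (c : A) (j : Fin r) → lookup (ys ∷ʳ c) (inject₁ j) ≡ lookup ys j
lookup-∷ʳ-inject₁ (y ∷ ys) c zero    = refl
lookup-∷ʳ-inject₁ (y ∷ ys) c (suc j) = lookup-∷ʳ-inject₁ ys c j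

lookup-map-tabulate : (f : A → B) (t : Fin k → A) (j : Fin k) → lookup (map f (tabulate t)) j ≡ f (t j)
lookup-map-tabulate f t j = trans (lookup-map j f (tabulate t)) (cong f (lookup∘tabulate t j))

∃-Vec? : ∀ k {P : Pred (Vec (Fin n) k) 0ℓ} → Decidable P → Dec (∃ P)
∃-Vec? zero    P? = map′ ([] ,_) (λ { ([] , p) → p }) (P? [])
∃-Vec? (suc k) P? = map′ (λ (x , xs , p) → x ∷ xs , p) (λ { (x ∷ xs , p) → x , xs , p })
                         (any? λ x → ∃-Vec? k (P? ∘ (x ∷_)))

module _ {m : ℕ} (ar : Fin m → ℕ) where

  Place : Set
  Place = Σ (Fin m) (Fin ∘ ar)

  minTuple-self : (p : Fin (suc r)) → minTuple ar r p p ≡ fromℕ r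
  minTuple-self p with p ≟ p
  ... | yes _   = refl
  ... | no p≢p = contradiction refl p≢p

  -- The entries of ts off position p, in the order in which minTuple r p binds them to y_1 … y_r.
  others : Fin (suc r) → Vec A (suc r) → Vec A r
  others p ts = tabulate (λ l → lookup ts (punchIn p (opposite l)))

  lookup-minTuple-others : (p : Fin (suc r)) (ts : Vec A (suc r)) →
    ∀ j → lookup (others p ts ∷ʳ lookup ts p) (minTuple ar r p j) ≡ lookup ts j
  lookup-minTuple-others p ts j with p ≟ j
  ... | yes refl = lookup-∷ʳ-fromℕ (others p ts) (lookup ts p)
  ... | no p≢j   = begin
    lookup (others p ts ∷ʳ lookup ts p) (inject₁ (opposite (punchOut p≢j)))
      ≡⟨ lookup-∷ʳ-inject₁ (others p ts) (lookup ts p) (opposite (punchOut p≢j)) ⟩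
    lookup (others p ts) (opposite (punchOut p≢j))
      ≡⟨ lookup∘tabulate _ (opposite (punchOut p≢j)) ⟩
    lookup ts (punchIn p (opposite (opposite (punchOut p≢j))))
      ≡⟨ cong (lookup ts ∘ punchIn p) (opposite-involutive (punchOut p≢j)) ⟩
    lookup ts (punchIn p (punchOut p≢j))
      ≡⟨ cong (lookup ts) (punchIn-punchOut p≢j) ⟩
    lookup ts j ∎
    where open ≡-Reasoning

  minTuple-others : (p : Fin (suc r)) (ts : Vec A (suc r)) →
    map (lookup (others p ts ∷ʳ lookup ts p)) (tabulate (minTuple ar r p)) ≡ ts
  minTuple-others p ts = lookup-extensionality _ ts λ j →
    trans (lookup-map-tabulate _ (minTuple ar _ p) j) (lookup-minTuple-others p ts j)

  occurrencePlace : (φ : Form ar k) {v : Fin k} → Occurs ar v φ → Place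
  occurrencePlace (atom i xs) o        = i , index o
  occurrencePlace (φ ∧ ψ)     (inj₁ o) = occurrencePlace φ o
  occurrencePlace (φ ∧ ψ)     (inj₂ o) = occurrencePlace ψ o
  occurrencePlace (ex φ)      o        = occurrencePlace φ o
  occurrencePlace (all φ)     o        = occurrencePlace φ o

  properPlace : (φ : Form ar k) → Proper ar φ → Place
  properPlace (φ ∧ ψ) (inj₁ pr) = properPlace φ pr
  properPlace (φ ∧ ψ) (inj₂ pr) = properPlace ψ pr
  properPlace (ex φ)  pr        = properPlace φ pr
  properPlace (all φ) (inj₁ o)  = occurrencePlace φ o
  properPlace (all φ) (inj₂ pr) = properPlace φ pr

  Occurs-exs : ∀ r (ψ : Form ar (suc r)) → Occurs ar (fromℕ r) ψ → Occurs ar zero (exs ar r ψ)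
  Occurs-exs zero    ψ o = o
  Occurs-exs (suc r) ψ o = Occurs-exs r (ex ψ) o

  minimal′-proper : ∀ a (mk : (Fin a → Fin a) → Form ar a) → (∀ t j → Occurs ar (t j) (mk t)) →
                    ∀ p → Proper ar (minimal′ ar a mk p)
  minimal′-proper (suc r) mk occurs p = inj₁ (Occurs-exs r (mk t)
    (subst (λ v → Occurs ar v (mk t)) (minTuple-self p) (occurs t p)))
    where t = minTuple ar r p

  minimal-proper : ∀ i p → Proper ar (minimal ar i p)
  minimal-proper i = minimal′-proper (ar i) (λ t → atom i (tabulate t)) ∈-tabulate⁺

placeIndex : ∀ {m} (ar : Fin m → ℕ) → Place ar → Fin (rσ ar)
placeIndex {suc m} ar (zero  , p) = p ↑ˡ rσ (ar ∘ suc)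
placeIndex {suc m} ar (suc i , p) = ar zero ↑ʳ placeIndex (ar ∘ suc) (i , p)

placeOf : ∀ {m} (ar : Fin m → ℕ) → Fin (rσ ar) → Place ar
placeOf {suc m} ar c with splitAt (ar zero) c
... | inj₁ p  = zero , p
... | inj₂ c′ with placeOf (ar ∘ suc) c′
...   | i , p = suc i , p

placeOf-placeIndex : ∀ {m} (ar : Fin m → ℕ) (q : Place ar) → placeOf ar (placeIndex ar q) ≡ q
placeOf-placeIndex {suc m} ar (zero , p)
  rewrite splitAt-↑ˡ (ar zero) p (rσ (ar ∘ suc)) = refl
placeOf-placeIndex {suc m} ar (suc i , p)
  rewrite splitAt-↑ʳ (ar zero) (rσ (ar ∘ suc)) (placeIndex (ar ∘ suc) (i , p))
        | placeOf-placeIndex (ar ∘ suc) (i , p) = refl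

module _ {m : ℕ} {ar : Fin m → ℕ} (S : Structure ar) where
  open Structure S

  OccursAt : Place ar → Carrier → Set
  OccursAt (i , p) a = ∃ λ (ts : Vec Carrier (ar i)) → rel i ts × lookup ts p ≡ a

  Covering : Place ar → Set
  Covering q = ∀ a → OccursAt q a

  Sat-exs : ∀ r (ψ : Form ar (suc r)) (c : Carrier) →
            Sat ar S (exs ar r ψ) (c ∷ []) ⇔ ∃ λ (ys : Vec Carrier r) → Sat ar S ψ (ys ∷ʳ c)
  Sat-exs zero    ψ c = mk⇔ ([] ,_) λ { ([] , s) → s }
  Sat-exs (suc r) ψ c = mk⇔
    (λ s → let ys , b , s′ = to (Sat-exs r (ex ψ) c) s in b ∷ ys , s′)
    (λ { (b ∷ ys , s) → from (Sat-exs r (ex ψ) c) (ys , b , s) })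

  ⊨minimal′⇔ : ∀ a (mk : (Fin a → Fin a) → Form ar a) (Q : Vec Carrier a → Set) →
               (∀ t env → Sat ar S (mk t) env ⇔ Q (map (lookup env) (tabulate t))) →
               ∀ p → _⊨_ ar S (minimal′ ar a mk p) ⇔ (∀ c → ∃ λ ts → Q ts × lookup ts p ≡ c)
  ⊨minimal′⇔ (suc r) mk Q Sat-mk p = mk⇔ covering satisfied
    where
    t = minTuple ar r p

    covering : _⊨_ ar S (minimal′ ar (suc r) mk p) → ∀ c → ∃ λ ts → Q ts × lookup ts p ≡ c
    covering s c =
      let ys , s′ = to (Sat-exs r (mk t) c) (s c) in
      map (lookup (ys ∷ʳ c)) (tabulate t) ,
      to (Sat-mk t (ys ∷ʳ c)) s′ ,
      trans (lookup-map-tabulate (lookup (ys ∷ʳ c)) t p)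
            (trans (cong (lookup (ys ∷ʳ c)) (minTuple-self ar p)) (lookup-∷ʳ-fromℕ ys c))

    satisfied : (∀ c → ∃ λ ts → Q ts × lookup ts p ≡ c) → _⊨_ ar S (minimal′ ar (suc r) mk p)
    satisfied cov c with cov c
    ... | ts , q , refl = from (Sat-exs r (mk t) c)
      (others ar p ts , from (Sat-mk t _) (subst Q (sym (minTuple-others ar p ts)) q))

  ⊨minimal⇔Covering : ∀ i p → _⊨_ ar S (minimal ar i p) ⇔ Covering (i , p)
  ⊨minimal⇔Covering i = ⊨minimal′⇔ (ar i) (λ t → atom i (tabulate t)) (rel i) (λ _ _ → ⇔-id _)

  -- a₀ instantiates the universal quantifiers that do not bind the occurring variable.
  module _ (a₀ : Carrier) where

    occurs-sound : (φ : Form ar k) {v : Fin k} (o : Occurs ar v φ) {env : Vec Carrier k} →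
                   Sat ar S φ env → OccursAt (occurrencePlace ar φ o) (lookup env v)
    occurs-sound (atom i xs) o {env} s =
      map (lookup env) xs , s , trans (lookup-map (index o) (lookup env) xs) (cong (lookup env) (sym (lookup-index o)))
    occurs-sound (φ ∧ ψ) (inj₁ o) (s , _) = occurs-sound φ o s
    occurs-sound (φ ∧ ψ) (inj₂ o) (_ , s) = occurs-sound ψ o s
    occurs-sound (ex φ)  o        (b , s) = occurs-sound φ o s
    occurs-sound (all φ) o        s       = occurs-sound φ o (s a₀)

    proper-sound : (φ : Form ar k) (pr : Proper ar φ) {env : Vec Carrier k} →
                   Sat ar S φ env → Covering (properPlace ar φ pr)
    proper-sound (φ ∧ ψ) (inj₁ pr) (s , _) = proper-sound φ pr s
    proper-sound (φ ∧ ψ) (inj₂ pr) (_ , s) = proper-sound ψ pr s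
    proper-sound (ex φ)  pr        (b , s) = proper-sound φ pr s
    proper-sound (all φ) (inj₁ o)  s c     = occurs-sound φ o (s c)
    proper-sound (all φ) (inj₂ pr) s       = proper-sound φ pr (s a₀)

  isolated⇒¬Covering : {e : Carrier} → Isolated ar S e → ∀ q → ¬ Covering q
  isolated⇒¬Covering {e} iso (i , p) cov with cov e
  ... | ts , r , refl = iso i ts r (∈-lookup p ts)

module _ {m : ℕ} {ar : Fin m → ℕ} (S : Structure ar) where
  open Structure S

  column : ∀ {k l} → Fin k → Vec (Vec Carrier k) l → Vec Carrier l
  column c = map (λ v → lookup v c)

  Covering-power : ∀ k {q} → Covering S q → Covering (power ar S k) q
  Covering-power k {i , p} cov e = ts , related , row-p
    where
    tuple : Fin k → Vec Carrier (ar i)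
    tuple c = proj₁ (cov (lookup e c))

    ts : Vec (Vec Carrier k) (ar i)
    ts = tabulate (λ j → tabulate (λ c → lookup (tuple c) j))

    column-ts : ∀ c → column c ts ≡ tuple c
    column-ts c = lookup-extensionality _ _ λ j →
      trans (lookup-map-tabulate (λ v → lookup v c) _ j) (lookup∘tabulate _ c)

    related : ∀ c → rel i (column c ts)
    related c = subst (rel i) (sym (column-ts c)) (proj₁ (proj₂ (cov (lookup e c))))

    row-p : lookup ts p ≡ e
    row-p = lookup-extensionality _ _ λ c →
      trans (cong (λ v → lookup v c) (lookup∘tabulate _ p))
            (trans (lookup∘tabulate _ c) (proj₂ (proj₂ (cov (lookup e c)))))

  Isolated-power : ∀ k (coordinate : Place ar → Fin k) (e : Vec Carrier k) →
                   (∀ q → ¬ OccursAt S q (lookup e (coordinate q))) → Isolated ar (power ar S k) e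
  Isolated-power k coordinate e avoids i ts related e∈ts =
    avoids (i , p) (column c ts , related c , e-at-p)
    where
    p = index e∈ts
    c = coordinate (i , p)

    e-at-p : lookup (column c ts) p ≡ lookup e c
    e-at-p = trans (lookup-map p _ ts) (cong (λ v → lookup v c) (sym (lookup-index e∈ts)))

  ∃Isolated-power-rσ : (∀ q → ∃ λ a → ¬ OccursAt S q a) → ∃ (Isolated ar (power ar S (rσ ar)))
  ∃Isolated-power-rσ uncovered = e , Isolated-power (rσ ar) (placeIndex ar) e avoids
    where
    e : Vec Carrier (rσ ar)
    e = tabulate (proj₁ ∘ uncovered ∘ placeOf ar)

    avoids : ∀ q → ¬ OccursAt S q (lookup e (placeIndex ar q))
    avoids q rewrite lookup∘tabulate (proj₁ ∘ uncovered ∘ placeOf ar) (placeIndex ar q)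
                   | placeOf-placeIndex ar q = proj₂ (uncovered q)

module _ {m : ℕ} {ar : Fin m → ℕ} {n : ℕ} (A : FinStructure ar n) where

  OccursAt? : ∀ q a → Dec (OccursAt (toStructure ar A) q a)
  OccursAt? (i , p) a = ∃-Vec? (ar i) λ ts → T? (FinStructure.rel A i ts) ×-dec (lookup ts p ≟ a)

  ¬Covering⇒uncovered : ∀ q → ¬ Covering (toStructure ar A) q → ∃ λ a → ¬ OccursAt (toStructure ar A) q a
  ¬Covering⇒uncovered q = ¬∀⟶∃¬ n _ (OccursAt? q)

mainTheorem10 : (m : ℕ) (ar : Fin m → ℕ) (n : ℕ) → 0 < n → (A : FinStructure ar n) →
    ((∀ (φ : PHSentence ar) → Proper ar φ → ¬ (_⊨_ ar (toStructure ar A) φ))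
      ⇔ (∀ (i : Fin m) (p : Fin (ar i)) → ¬ (_⊨_ ar (toStructure ar A) (minimal ar i p))))
  × ((∀ (i : Fin m) (p : Fin (ar i)) → ¬ (_⊨_ ar (toStructure ar A) (minimal ar i p)))
      ⇔ ∃ (Isolated ar (power ar (toStructure ar A) (rσ ar))))
mainTheorem10 m ar (suc n) (s≤s z≤n) A =
    mk⇔ (λ none i p → none (minimal ar i p) (minimal-proper ar i p))
        (λ noMinimal φ pr s → let i , p = properPlace ar φ pr in
           noMinimal i p (from (⊨minimal⇔Covering S i p) (proper-sound S zero φ pr s)))
  , mk⇔ (λ noMinimal → ∃Isolated-power-rσ S λ (i , p) →
           ¬Covering⇒uncovered A (i , p) (noMinimal i p ∘ from (⊨minimal⇔Covering S i p)))
        (λ (e , isolated) i p s → isolated⇒¬Covering (power ar S (rσ ar)) isolated (i , p)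
           (Covering-power S (rσ ar) (to (⊨minimal⇔Covering S i p) s)))
  where
  S = toStructure ar A
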